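{- Let $G_\sigma=(V,E;\sigma)$ be a sign-connected signed graph with $|V|>1$. An edge $e$ is a sign isthmus if and only if $e$ is an isthmus or a balancing edge.
   Context: A signed graph consists of a finite undirected graph, in which loops and multiple edges are allowed, with signs $\sigma:E\to\{\pm1\}$. Cycles are elementary; a loop is a cycle of length 1. Chains are walks. Signs of cycles and chains are products of their edge signs, counted with multiplicity. Balanced means every cycle is positive. Vertices $x,y$ are sign connected if $x=y$ or both a positive and a negative chain join them. The signed graph is sign connected if every two vertices are sign connected. For a sign-connected $G_\sigma$, an edge $e$ is a sign isthmus if $G_\sigma-e$ is not sign connected. An isthmus is an edge whose deletion increases the number of connected components. For a connected unbalanced signed graph, a balancing edge is an edge $e$ such that $G_\sigma-e$ is balanced. -}

module Defs where

open import Data.Nat using (ℕ; zero; suc; _<_; _≥_)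
open import Data.Fin using (Fin; punchIn)
open import Data.Product using (Σ; _×_; _,_; ∃)
open import Data.Sum using (_⊎_)
open import Data.List using (List; []; _∷_; length)
open import Data.List.Relation.Unary.Unique.Propositional using (Unique)
open import Relation.Binary.PropositionalEquality using (_≡_)
open import Relation.Nullary using (¬_)
open import Function using (Surjective)
open import Function.Bundles using (_⇔_)

data Sign : Set where
  pos neg : Sign

_·_ : Sign → Sign → Sign
pos · s = s
neg · pos = neg
neg · neg = pos

-- A finite signed graph with vertex set Fin n and edge set Fin m.
-- Loops (ends e = (x , x)) and multiple edges are allowed.
record SGraph (n m : ℕ) : Set where
  field
    ends : Fin m → Fin n × Fin n
    sign : Fin m → Sign
open SGraph public

_─_ : ∀ {n m} → SGraph n (suc m) → Fin (suc m) → SGraph n m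
ends (G ─ e) i = ends G (punchIn e i)
sign (G ─ e) i = sign G (punchIn e i)

module _ {n m : ℕ} (G : SGraph n m) where

  Joins : Fin m → Fin n → Fin n → Set
  Joins e x y = (ends G e ≡ (x , y)) ⊎ (ends G e ≡ (y , x))

  data Walk : Fin n → Fin n → Set where
    nil  : ∀ {x} → Walk x x
    step : ∀ {x y z} (e : Fin m) → Joins e x y → Walk y z → Walk x z

  walkSign : ∀ {x y} → Walk x y → Sign
  walkSign nil = pos
  walkSign (step e _ w) = sign G e · walkSign w

  walkEdges : ∀ {x y} → Walk x y → List (Fin m)
  walkEdges nil = []
  walkEdges (step e _ w) = e ∷ walkEdges w

  -- vertices at which each step starts (for a closed walk: each visited vertex once)
  walkVerts : ∀ {x y} → Walk x y → List (Fin n)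
  walkVerts nil = []
  walkVerts {x} (step e _ w) = x ∷ walkVerts w

  -- elementary cycle through x: a closed chain of length ≥ 1 with no repeated
  -- edge and no repeated vertex (other than start = end). A loop is a cycle of length 1.
  record Cycle (x : Fin n) : Set where
    field
      walk     : Walk x x
      nonempty : length (walkEdges walk) ≥ 1
      uniqV    : Unique (walkVerts walk)
      uniqE    : Unique (walkEdges walk)

  Balanced : Set
  Balanced = ∀ x (c : Cycle x) → walkSign (Cycle.walk c) ≡ pos

  Connected : Set
  Connected = ∀ x y → Walk x y

  SignConnectedVerts : Fin n → Fin n → Set
  SignConnectedVerts x y =
    (x ≡ y) ⊎ ((Σ (Walk x y) λ w → walkSign w ≡ pos) × (Σ (Walk x y) λ w → walkSign w ≡ neg))

  SignConnected : Set
  SignConnected = ∀ x y → SignConnectedVerts x y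

  -- G has exactly k connected components: a surjective labelling of vertices by Fin k
  -- whose fibres are exactly the connected components.
  HasComponents : ℕ → Set
  HasComponents k = Σ (Fin n → Fin k) λ c →
    Surjective _≡_ _≡_ c × (∀ x y → (c x ≡ c y) ⇔ Walk x y)

module _ {n m : ℕ} (G : SGraph n (suc m)) (e : Fin (suc m)) where

  Isthmus : Set
  Isthmus = Σ ℕ λ k → Σ ℕ λ k' → HasComponents G k × HasComponents (G ─ e) k' × k < k'

  BalancingEdge : Set
  BalancingEdge = Connected G × ¬ Balanced G × Balanced (G ─ e)

  -- (used when G is sign connected) G - e is not sign connected
  SignIsthmus : Set
  SignIsthmus = ¬ SignConnected (G ─ e)

module Submission where

-- The argument rests on three general facts about a signed graph K.
--   (1) If K is balanced, every closed chain is positive.  A closed chain that is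
--       not an elementary cycle repeats a vertex or an edge, and then its sign is
--       the product of the signs of two strictly shorter closed chains; induction
--       on the length finishes.  Consequently a sign-connected graph with two
--       distinct vertices is unbalanced (a positive and a negative chain between
--       them close up to a negative closed chain).
--   (2) If K is connected and has a negative closed chain, K is sign connected:
--       inserting the closed chain into a chain flips its sign.
--   (3) Reachability in K is decidable, by induction on the number of edges: a
--       chain in K either avoids a chosen edge e, or both of its ends reach an
--       end of e in K - e.  This lets us label the components of K - e.
-- For the theorem, let a, b be the ends of e in G and H = G - e.  If a and b are
-- joined in H, then H is connected and, by (2), sign-disconnected H is balanced,
-- so e is a balancing edge.  Otherwise H has exactly two components (those of a
-- and of b) while G has one, so e is an isthmus.  Conversely an isthmus leaves H
-- disconnected, and a balancing edge leaves H balanced, hence by (1) not sign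
-- connected.

open import Defs
open import Data.Nat using (ℕ; zero; suc; _<_; _≤_; _+_; z≤n; s≤s; s≤s⁻¹)
open import Data.Nat.Properties using (≤-trans; ≤-refl; +-suc; m<m+n; m<n+m; m≤m+n; m≤n+m; m≤n⇒m≤1+n)
open import Data.Fin using (Fin; punchIn; punchOut) renaming (zero to fzero; suc to fsuc)
open import Data.Fin.Properties using (punchIn-punchOut) renaming (_≟_ to _≟F_)
open import Data.Product using (Σ; _×_; _,_; proj₁; proj₂)
open import Data.Sum using (_⊎_; inj₁; inj₂)
import Data.Sum as Sum
open import Data.List.Relation.Unary.All.Properties using (¬Any⇒All¬)
open import Data.List.Relation.Unary.Any using (Any; here; there)
import Data.List.Relation.Unary.Any as Any
open import Data.List.Relation.Unary.AllPairs using ([]; _∷_)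
open import Data.List.Relation.Unary.Unique.Propositional using (Unique)
open import Data.Empty using (⊥-elim)
open import Relation.Nullary using (¬_; Dec; yes; no)
open import Relation.Nullary.Decidable using (_×-dec_; _⊎-dec_)
open import Relation.Binary.PropositionalEquality
  using (_≡_; _≢_; refl; sym; trans; cong; cong₂; subst; module ≡-Reasoning)
open import Function.Bundles using (_⇔_; mk⇔; Equivalence)

·-assoc : ∀ a b c → (a · b) · c ≡ a · (b · c)
·-assoc pos b c = refl
·-assoc neg pos c = refl
·-assoc neg neg pos = refl
·-assoc neg neg neg = refl

·-comm : ∀ a b → a · b ≡ b · a
·-comm pos pos = refl
·-comm pos neg = refl
·-comm neg pos = refl
·-comm neg neg = refl

·-identityʳ : ∀ a → a · pos ≡ a
·-identityʳ pos = refl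
·-identityʳ neg = refl

·-left-comm : ∀ a b c → a · (b · c) ≡ b · (a · c)
·-left-comm pos b c = refl
·-left-comm neg pos c = refl
·-left-comm neg neg c = refl

·-cancelˡ : ∀ a b → a · (a · b) ≡ b
·-cancelˡ pos b = refl
·-cancelˡ neg pos = refl
·-cancelˡ neg neg = refl

sign-cases : ∀ s → (s ≡ pos × neg · s ≡ neg) ⊎ (s ≡ neg × neg · s ≡ pos)
sign-cases pos = inj₁ (refl , refl)
sign-cases neg = inj₂ (refl , refl)

module Chains {n m : ℕ} (K : SGraph n m) where

  sg : ∀ {x y} → Walk K x y → Sign
  sg = walkSign K

  len : ∀ {x y} → Walk K x y → ℕ
  len nil = 0
  len (step _ _ w) = suc (len w)

  infixr 5 _++_
  _++_ : ∀ {x y z} → Walk K x y → Walk K y z → Walk K x z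
  nil ++ v = v
  step i j w ++ v = step i j (w ++ v)

  sg-++ : ∀ {x y z} (w : Walk K x y) (v : Walk K y z) → sg (w ++ v) ≡ sg w · sg v
  sg-++ nil v = refl
  sg-++ (step i j w) v =
    trans (cong (sign K i ·_) (sg-++ w v)) (sym (·-assoc (sign K i) (sg w) (sg v)))

  len-++ : ∀ {x y z} (w : Walk K x y) (v : Walk K y z) → len (w ++ v) ≡ len w + len v
  len-++ nil v = refl
  len-++ (step i j w) v = cong suc (len-++ w v)

  len-++-pos : ∀ {x y z} (w : Walk K x y) (v : Walk K y z) → 0 < len v → 0 < len (w ++ v)
  len-++-pos nil v v>0 = v>0
  len-++-pos (step i j w) v _ = s≤s z≤n

  flip-joins : ∀ {i x y} → Joins K i x y → Joins K i y x
  flip-joins (inj₁ p) = inj₂ p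
  flip-joins (inj₂ p) = inj₁ p

  rev : ∀ {x y} → Walk K x y → Walk K y x
  rev nil = nil
  rev (step i j w) = rev w ++ step i (flip-joins j) nil

  sg-rev : ∀ {x y} (w : Walk K x y) → sg (rev w) ≡ sg w
  sg-rev nil = refl
  sg-rev (step i j w) = begin
    sg (rev w ++ step i (flip-joins j) nil) ≡⟨ sg-++ (rev w) (step i (flip-joins j) nil) ⟩
    sg (rev w) · (sign K i · pos)           ≡⟨ cong₂ _·_ (sg-rev w) (·-identityʳ (sign K i)) ⟩
    sg w · sign K i                         ≡⟨ ·-comm (sg w) (sign K i) ⟩
    sign K i · sg w                         ∎
    where open ≡-Reasoning

  sg-insert : ∀ {x v y} (w₁ : Walk K x v) (d : Walk K v v) (w₃ : Walk K v y) →
    sg (w₁ ++ (d ++ w₃)) ≡ sg d · sg (w₁ ++ w₃)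
  sg-insert nil d w₃ = sg-++ d w₃
  sg-insert (step i j w₁) d w₃ =
    trans (cong (sign K i ·_) (sg-insert w₁ d w₃)) (·-left-comm (sign K i) (sg d) (sg (w₁ ++ w₃)))

  len-insert : ∀ {x v y} (w₁ : Walk K x v) (d : Walk K v v) (w₃ : Walk K v y) →
    len (w₁ ++ (d ++ w₃)) ≡ len d + len (w₁ ++ w₃)
  len-insert nil d w₃ = len-++ d w₃
  len-insert (step i j w₁) d w₃ = trans (cong suc (len-insert w₁ d w₃)) (sym (+-suc (len d) _))

  sg-backtrack : ∀ {x u v u' y i} (p : Walk K x u) (j₁ : Joins K i u v) (q : Walk K v u')
    (j₂ : Joins K i u' u) (r : Walk K u y) →
    sg (p ++ step i j₁ (q ++ step i j₂ r)) ≡ sg q · sg (p ++ r)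
  sg-backtrack {i = i} nil j₁ q j₂ r = begin
    sign K i · sg (q ++ step i j₂ r)  ≡⟨ cong (sign K i ·_) (sg-++ q (step i j₂ r)) ⟩
    sign K i · (sg q · (sign K i · sg r)) ≡⟨ ·-left-comm (sign K i) (sg q) _ ⟩
    sg q · (sign K i · (sign K i · sg r)) ≡⟨ cong (sg q ·_) (·-cancelˡ (sign K i) (sg r)) ⟩
    sg q · sg r                        ∎
    where open ≡-Reasoning
  sg-backtrack (step i' j p) j₁ q j₂ r =
    trans (cong (sign K i' ·_) (sg-backtrack p j₁ q j₂ r)) (·-left-comm (sign K i') (sg q) _)

  len-backtrack : ∀ {x u v u' y i} (p : Walk K x u) (j₁ : Joins K i u v) (q : Walk K v u')
    (j₂ : Joins K i u' u) (r : Walk K u y) →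
    len (p ++ step i j₁ (q ++ step i j₂ r)) ≡ 2 + (len q + len (p ++ r))
  len-backtrack nil j₁ q j₂ r = cong suc (trans (len-++ q _) (+-suc (len q) (len r)))
  len-backtrack (step i' j p) j₁ q j₂ r =
    trans (cong suc (len-backtrack p j₁ q j₂ r)) (cong (2 +_) (sym (+-suc (len q) _)))

  split-at-vertex : ∀ {x y v} (w : Walk K x y) → Any (v ≡_) (walkVerts K w) →
    Σ (Walk K x v) λ w₁ → Σ (Walk K v y) λ w₂ → 0 < len w₂ × w ≡ w₁ ++ w₂
  split-at-vertex (step i j w) (here refl) = nil , step i j w , s≤s z≤n , refl
  split-at-vertex (step i j w) (there v∈) with split-at-vertex w v∈
  ... | w₁ , w₂ , w₂>0 , eq = step i j w₁ , w₂ , w₂>0 , cong (step i j) eq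

  split-at-edge : ∀ {x y i} (w : Walk K x y) → Any (i ≡_) (walkEdges K w) →
    Σ (Fin n) λ u → Σ (Fin n) λ v → Σ (Walk K x u) λ p → Σ (Joins K i u v) λ j →
    Σ (Walk K v y) λ r → w ≡ p ++ step i j r
  split-at-edge (step i j w) (here refl) = _ , _ , nil , j , w , refl
  split-at-edge (step i j w) (there i∈) with split-at-edge w i∈
  ... | u , v , p , j' , r , eq = u , v , step i j p , j' , r , cong (step i j) eq

  data VertexSplit {x y} (w : Walk K x y) : Set where
    vertex-unique : Unique (walkVerts K w) → VertexSplit w
    vertex-repeat : ∀ {v} (w₁ : Walk K x v) (d : Walk K v v) (w₃ : Walk K v y) →
      0 < len d → 0 < len w₃ → w ≡ w₁ ++ (d ++ w₃) → VertexSplit w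

  vertex-split : ∀ {x y} (w : Walk K x y) → VertexSplit w
  vertex-split nil = vertex-unique []
  vertex-split {x} (step i j w) with vertex-split w
  ... | vertex-repeat w₁ d w₃ d>0 w₃>0 eq =
    vertex-repeat (step i j w₁) d w₃ d>0 w₃>0 (cong (step i j) eq)
  ... | vertex-unique u with Any.any? (x ≟F_) (walkVerts K w)
  ...   | no x∉ = vertex-unique (¬Any⇒All¬ _ x∉ ∷ u)
  ...   | yes x∈ with split-at-vertex w x∈
  ...     | w₁ , w₃ , w₃>0 , eq = vertex-repeat nil (step i j w₁) w₃ (s≤s z≤n) w₃>0 (cong (step i j) eq)

  data EdgeSplit {x y} (w : Walk K x y) : Set where
    edge-unique : Unique (walkEdges K w) → EdgeSplit w
    edge-repeat : ∀ {u v u' v' i} (p : Walk K x u) (j₁ : Joins K i u v) (q : Walk K v u')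
      (j₂ : Joins K i u' v') (r : Walk K v' y) → w ≡ p ++ step i j₁ (q ++ step i j₂ r) → EdgeSplit w

  edge-split : ∀ {x y} (w : Walk K x y) → EdgeSplit w
  edge-split nil = edge-unique []
  edge-split (step i j w) with edge-split w
  ... | edge-repeat p j₁ q j₂ r eq = edge-repeat (step i j p) j₁ q j₂ r (cong (step i j) eq)
  ... | edge-unique u with Any.any? (i ≟F_) (walkEdges K w)
  ...   | no i∉ = edge-unique (¬Any⇒All¬ _ i∉ ∷ u)
  ...   | yes i∈ with split-at-edge w i∈
  ...     | _ , _ , q , j₂ , r , eq = edge-repeat nil j q j₂ r (cong (step i j) eq)

  data Orientation {i u v u' v'} (j₁ : Joins K i u v) (j₂ : Joins K i u' v') : Set where
    same     : u ≡ u' → v ≡ v' → Orientation j₁ j₂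
    opposite : u ≡ v' → v ≡ u' → Orientation j₁ j₂

  orientation : ∀ {i u v u' v'} (j₁ : Joins K i u v) (j₂ : Joins K i u' v') → Orientation j₁ j₂
  orientation (inj₁ p) (inj₁ q) = same (cong proj₁ (trans (sym p) q)) (cong proj₂ (trans (sym p) q))
  orientation (inj₁ p) (inj₂ q) = opposite (cong proj₁ (trans (sym p) q)) (cong proj₂ (trans (sym p) q))
  orientation (inj₂ p) (inj₁ q) = opposite (cong proj₂ (trans (sym p) q)) (cong proj₁ (trans (sym p) q))
  orientation (inj₂ p) (inj₂ q) = same (cong proj₂ (trans (sym p) q)) (cong proj₁ (trans (sym p) q))

  data Reduction {x} (c : Walk K x x) : Set where
    cycle : Unique (walkVerts K c) → Unique (walkEdges K c) → Reduction c
    split : ∀ {u v} (d : Walk K u u) (d' : Walk K v v) →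
      len d < len c → len d' < len c → sg c ≡ sg d · sg d' → Reduction c

  reduce-insert : ∀ {x v} (w₁ : Walk K x v) (d : Walk K v v) (w₃ : Walk K v x) →
    0 < len d → 0 < len w₃ → Reduction (w₁ ++ (d ++ w₃))
  reduce-insert w₁ d w₃ d>0 w₃>0 = split d (w₁ ++ w₃)
    (subst (len d <_) (sym (len-insert w₁ d w₃)) (m<m+n (len d) (len-++-pos w₁ w₃ w₃>0)))
    (subst (len (w₁ ++ w₃) <_) (sym (len-insert w₁ d w₃)) (m<n+m (len (w₁ ++ w₃)) d>0))
    (sg-insert w₁ d w₃)

  reduce-backtrack : ∀ {x u v i} (p : Walk K x u) (j₁ : Joins K i u v) (q : Walk K v v)
    (j₂ : Joins K i v u) (r : Walk K u x) → Reduction (p ++ step i j₁ (q ++ step i j₂ r))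
  reduce-backtrack p j₁ q j₂ r = split q (p ++ r)
    (subst (len q <_) (sym (len-backtrack p j₁ q j₂ r)) (s≤s (m≤n⇒m≤1+n (m≤m+n (len q) _))))
    (subst (len (p ++ r) <_) (sym (len-backtrack p j₁ q j₂ r))
      (s≤s (m≤n⇒m≤1+n (m≤n+m (len (p ++ r)) (len q)))))
    (sg-backtrack p j₁ q j₂ r)

  reduce : ∀ {x y} i (j : Joins K i x y) (w : Walk K y x) → Reduction (step i j w)
  reduce i j w with vertex-split (step i j w)
  ... | vertex-repeat w₁ d w₃ d>0 w₃>0 eq = subst Reduction (sym eq) (reduce-insert w₁ d w₃ d>0 w₃>0)
  ... | vertex-unique uv with edge-split (step i j w)
  ...   | edge-unique ue = cycle uv ue
  ...   | edge-repeat p j₁ q j₂ r eq with orientation j₁ j₂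
  ...     | same refl refl =
    subst Reduction (sym eq) (reduce-insert p (step _ j₁ q) (step _ j₂ r) (s≤s z≤n) (s≤s z≤n))
  ...     | opposite refl refl = subst Reduction (sym eq) (reduce-backtrack p j₁ q j₂ r)

  closed-positive : Balanced K → ∀ {x} (c : Walk K x x) → sg c ≡ pos
  closed-positive bal c = bounded (len c) c ≤-refl
    where
      bounded : ∀ k {x} (c : Walk K x x) → len c ≤ k → sg c ≡ pos
      bounded k nil _ = refl
      bounded (suc k) (step i j w) le with reduce i j w
      ... | cycle uv ue =
        bal _ record { walk = step i j w ; nonempty = s≤s z≤n ; uniqV = uv ; uniqE = ue }
      ... | split d d' d< d'< eq = trans eq (cong₂ _·_
        (bounded k d (s≤s⁻¹ (≤-trans d< le))) (bounded k d' (s≤s⁻¹ (≤-trans d'< le))))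

  sign-connected-unbalanced : 1 < n → SignConnected K → ¬ Balanced K
  sign-connected-unbalanced (s≤s (s≤s _)) sc bal with sc fzero (fsuc fzero)
  ... | inj₁ ()
  ... | inj₂ ((w₊ , w₊≡pos) , (w₋ , w₋≡neg)) with closed-positive bal (w₊ ++ rev w₋)
  ... | c≡pos rewrite sg-++ w₊ (rev w₋) | sg-rev w₋ | w₊≡pos | w₋≡neg with c≡pos
  ... | ()

  sign-connected⇒connected : SignConnected K → Connected K
  sign-connected⇒connected sc x y with sc x y
  ... | inj₁ refl = nil
  ... | inj₂ ((w , _) , _) = w

  opposite-chains : ∀ {x y} (w w' : Walk K x y) → sg w' ≡ neg · sg w → SignConnectedVerts K x y
  opposite-chains w w' w'≡-w with sign-cases (sg w)
  ... | inj₁ (w₊ , -w₋) = inj₂ ((w , w₊) , (w' , trans w'≡-w -w₋))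
  ... | inj₂ (w₋ , -w₊) = inj₂ ((w' , trans w'≡-w -w₊) , (w , w₋))

  negative-closed⇒sign-connected : Connected K → ∀ {z} (c : Walk K z z) → sg c ≡ neg → SignConnected K
  negative-closed⇒sign-connected conn {z} c c≡neg x y =
    opposite-chains (conn x z ++ conn z y) (conn x z ++ (c ++ conn z y))
      (trans (sg-insert (conn x z) c (conn z y)) (cong (_· sg (conn x z ++ conn z y)) c≡neg))

module Deletion {n m : ℕ} (G : SGraph n (suc m)) (e : Fin (suc m)) where
  H : SGraph n m
  H = G ─ e

  open Chains H
  open Chains G using () renaming (_++_ to _++ᴳ_; rev to revᴳ)

  a b : Fin n
  a = proj₁ (ends G e)
  b = proj₂ (ends G e)

  lift : ∀ {x y} → Walk H x y → Walk G x y
  lift nil = nil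
  lift (step i j w) = step (punchIn e i) j (lift w)

  EndReach : Fin n → Set
  EndReach x = Walk H x a ⊎ Walk H x b

  endpoint-reach : ∀ {x y} → Joins G e x y → EndReach x
  endpoint-reach {x} (inj₁ p) = inj₁ (subst (Walk H x) (sym (cong proj₁ p)) nil)
  endpoint-reach {x} (inj₂ p) = inj₂ (subst (Walk H x) (sym (cong proj₂ p)) nil)

  unlift-joins : ∀ {i x y} (e≢i : e ≢ i) → Joins G i x y → Joins H (punchOut e≢i) x y
  unlift-joins e≢i = subst (λ t → Joins G t _ _) (sym (punchIn-punchOut e≢i))

  first-use : ∀ {x y} → Walk G x y → Walk H x y ⊎ EndReach x
  first-use nil = inj₁ nil
  first-use (step i j w) with e ≟F i
  ... | yes refl = inj₂ (endpoint-reach j)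
  ... | no e≢i = Sum.map prepend (Sum.map prepend prepend) (first-use w)
    where
      prepend : ∀ {z} → Walk H _ z → Walk H _ z
      prepend = step (punchOut e≢i) (unlift-joins e≢i j)

  reach-a : ∀ {x} → EndReach x → Walk G x a
  reach-a (inj₁ w) = lift w
  reach-a (inj₂ w) = lift w ++ᴳ step e (inj₂ refl) nil

  via-e : ∀ {x y} → EndReach x → EndReach y → Walk G x y
  via-e rx ry = reach-a rx ++ᴳ revᴳ (reach-a ry)

  not-via-e : ∀ {x y} → ¬ Walk H x y → Walk G x y → EndReach x × EndReach y
  not-via-e ¬xy w with first-use w | first-use (revᴳ w)
  ... | inj₁ xy | _ = ⊥-elim (¬xy xy)
  ... | _ | inj₁ yx = ⊥-elim (¬xy (rev yx))
  ... | inj₂ rx | inj₂ ry = rx , ry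

dec-walk : ∀ {n m} (K : SGraph n m) x y → Dec (Walk K x y)
dec-walk {m = zero} K x y with x ≟F y
... | yes refl = yes nil
... | no x≢y = no λ { nil → x≢y refl ; (step () _ _) }
dec-walk {m = suc m} K x y with dec-walk H x y | end-reach? x ×-dec end-reach? y
  where
    open Deletion K fzero
    end-reach? : ∀ z → Dec (EndReach z)
    end-reach? z = dec-walk H z a ⊎-dec dec-walk H z b
... | yes xy | _ = yes (Deletion.lift K fzero xy)
... | no _ | yes (rx , ry) = yes (Deletion.via-e K fzero rx ry)
... | no ¬xy | no ¬ends = no λ w → ¬ends (Deletion.not-via-e K fzero ¬xy w)

module Components {n m : ℕ} (K : SGraph n m) where
  open Chains K

  one-component : Fin n → Connected K → HasComponents K 1
  one-component x₀ conn =
    (λ _ → fzero) , (λ { fzero → x₀ , λ _ → refl }) , λ x y → mk⇔ (λ _ → conn x y) (λ _ → refl)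

  two-components : ∀ {a b} → ¬ Walk K a b → (∀ x → Walk K x a ⊎ Walk K x b) → HasComponents K 2
  two-components {a} {b} ¬ab reach = side , surjective , λ x y → mk⇔ (joined x y) (same-side x y)
    where
      label : ∀ {P : Set} → Dec P → Fin 2
      label (yes _) = fzero
      label (no _) = fsuc fzero

      side : Fin n → Fin 2
      side x = label (dec-walk K x a)

      side-a : side a ≡ fzero
      side-a with dec-walk K a a
      ... | yes _ = refl
      ... | no ¬aa = ⊥-elim (¬aa nil)

      side-b : side b ≡ fsuc fzero
      side-b with dec-walk K b a
      ... | yes ba = ⊥-elim (¬ab (rev ba))
      ... | no _ = refl

      surjective : ∀ t → Σ (Fin n) λ x → ∀ {z} → z ≡ x → side z ≡ t
      surjective fzero = a , λ { refl → side-a }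
      surjective (fsuc fzero) = b , λ { refl → side-b }

      reach-b : ∀ {x} → ¬ Walk K x a → Walk K x b
      reach-b {x} ¬xa = Sum.[ (λ xa → ⊥-elim (¬xa xa)) , (λ xb → xb) ]′ (reach x)

      joined : ∀ x y → side x ≡ side y → Walk K x y
      joined x y eq with dec-walk K x a | dec-walk K y a
      joined x y eq | yes xa | yes ya = xa ++ rev ya
      joined x y () | yes _ | no _
      joined x y () | no _ | yes _
      joined x y eq | no ¬xa | no ¬ya = reach-b ¬xa ++ rev (reach-b ¬ya)

      same-side : ∀ x y → Walk K x y → side x ≡ side y
      same-side x y w with dec-walk K x a | dec-walk K y a
      ... | yes _ | yes _ = refl
      ... | yes xa | no ¬ya = ⊥-elim (¬ya (rev w ++ xa))
      ... | no ¬xa | yes ya = ⊥-elim (¬xa (w ++ ya))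
      ... | no _ | no _ = refl

  disconnected : ∀ {k} → HasComponents K k → 1 < k → ¬ Connected K
  disconnected (c , surj , fibres) (s≤s (s≤s _)) conn with surj fzero | surj (fsuc fzero)
  ... | x , cx | y , cy with trans (sym (cx refl)) (trans (Equivalence.from (fibres x y) (conn x y)) (cy refl))
  ... | ()

module SignConnectedDeletion {n m : ℕ} (G : SGraph n (suc m)) (sc : SignConnected G) (e : Fin (suc m)) where
  open Deletion G e
  open Chains H

  connected : Connected G
  connected = Chains.sign-connected⇒connected G sc

  end-reach : ∀ x → EndReach x
  end-reach x = Sum.[ inj₁ , (λ r → r) ]′ (first-use (connected x a))

  connected-H : Walk H a b → Connected H
  connected-H ab x y = to-a x ++ rev (to-a y)
    where
      to-a : ∀ z → Walk H z a
      to-a z = Sum.[ (λ za → za) , (λ zb → zb ++ rev ab) ]′ (end-reach z)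

  balanced-H : Walk H a b → ¬ SignConnected H → Balanced H
  balanced-H ab ¬sc x γ with walkSign H (Cycle.walk γ) in γ-sign
  ... | pos = refl
  ... | neg = ⊥-elim (¬sc (negative-closed⇒sign-connected (connected-H ab) (Cycle.walk γ) γ-sign))

  isthmus-disconnects : Fin n → Isthmus G e → ¬ Connected H
  isthmus-disconnects x₀ (k , k' , (c , _) , comps-H , k<k') =
    Components.disconnected H comps-H (≤-trans (s≤s (inhabited (c x₀))) k<k')
    where
      inhabited : Fin k → 0 < k
      inhabited fzero = s≤s z≤n
      inhabited (fsuc _) = s≤s z≤n

proposition3p7 : ∀ {n m : ℕ} (G : SGraph n (suc m)) → 1 < n → SignConnected G →
    (e : Fin (suc m)) → SignIsthmus G e ⇔ (Isthmus G e ⊎ BalancingEdge G e)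
proposition3p7 {suc n} G 1<n sc e = mk⇔ forward backward
  where
    open Deletion G e
    open SignConnectedDeletion G sc e

    forward : SignIsthmus G e → Isthmus G e ⊎ BalancingEdge G e
    forward ¬sc with dec-walk H a b
    ... | yes ab = inj₂ (connected , Chains.sign-connected-unbalanced G 1<n sc , balanced-H ab ¬sc)
    ... | no ¬ab = inj₁ (1 , 2 , Components.one-component G fzero connected ,
                         Components.two-components H ¬ab end-reach , s≤s (s≤s z≤n))

    backward : Isthmus G e ⊎ BalancingEdge G e → SignIsthmus G e
    backward (inj₁ isthmus) sc-H =
      isthmus-disconnects fzero isthmus (Chains.sign-connected⇒connected H sc-H)
    backward (inj₂ (_ , _ , balanced)) sc-H = Chains.sign-connected-unbalanced H 1<n sc-H balanced
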